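{- For all positive integers $k_1,\dots,k_d$, let $\mathcal{G} := \mathcal{C}_{k_1}\boxtimes\cdots\boxtimes\mathcal{C}_{k_d}$. Then $$\chi^f_{\Delta}(\mathcal{G}) = \chi^f_{\star}(\mathcal{G}) = \chi^f(\mathcal{G}) = \chi_{\Delta}(\mathcal{G}) = \chi_{\star}(\mathcal{G}) = \chi(\mathcal{G}) = \prod_{i=1}^d k_i.$$
   Context: The strong product $A\boxtimes B$ of graphs $A,B$ has vertex set $V(A)\times V(B)$, with distinct $(v,x),(w,y)$ adjacent iff ($v=w$ and $xy\in E(B)$) or ($x=y$ and $vw\in E(A)$) or ($vw\in E(A)$ and $xy\in E(B)$). For graph classes, $\mathcal{G}_1\boxtimes\cdots\boxtimes\mathcal{G}_d := \{G_1\boxtimes\cdots\boxtimes G_d : G_i\in\mathcal{G}_i\}$. For $k,n\in\mathbb{N}$, $T_{k,n}$ is the rooted tree in which every leaf is at distance $k-1$ from the root and every non-leaf vertex has $n$ children; $C_{k,n}$ is obtained from $T_{k,n}$ by adding an edge between every ancestor–descendant pair; $\mathcal{C}_k := \{C_{k,n}: n\in\mathbb{N}\}$. For $p\ge q$, a $(p\!:\!q)$-colouring of $G$ assigns to each vertex a $q$-subset of a palette of $p$ colours; it is a fractional $t$-colouring if $p/q\le t$. For a colour $\alpha$, the monochromatic subgraph is the subgraph induced by vertices whose set contains $\alpha$; its components are monochromatic components. The colouring has defect $c$ if every monochromatic subgraph has maximum degree at most $c$, clustering $c$ if every monochromatic component has at most $c$ vertices, and is proper if every monochromatic component has one vertex.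 An ordinary $k$-colouring is a $(k\!:\!1)$-colouring. For a class $\mathcal{G}$: $\chi(\mathcal{G})$ is the supremum of $\chi(G)$ over $G\in\mathcal{G}$; $\chi^f(\mathcal{G})$ is the supremum of fractional chromatic numbers; $\chi_{\Delta}(\mathcal{G})$ (resp. $\chi_\star(\mathcal{G})$) is the least $k$ such that for some $c$ every graph in $\mathcal{G}$ has a $k$-colouring with defect (resp. clustering) $c$; $\chi^f_\Delta(\mathcal{G})$ (resp. $\chi^f_\star(\mathcal{G})$) is the infimum of $t\in\mathbb{R}$ such that for some $c\in\mathbb{N}$ every graph in $\mathcal{G}$ has a fractional $t$-colouring with defect (resp. clustering) $c$. -}

module Defs where

open import Data.Nat using (ℕ; zero; suc; _+_; _*_; _∸_; _≤_; _<_)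
open import Data.Fin using (Fin)
open import Data.Fin.Subset using (Subset; _∈_; ∣_∣)
open import Data.List using (List; length; _++_)
open import Data.Vec using (Vec; []; _∷_)
open import Data.Product using (Σ; Σ-syntax; _×_; _,_; proj₁)
open import Data.Sum using (_⊎_)
open import Relation.Nullary using (¬_)
open import Relation.Binary.PropositionalEquality using (_≡_; _≢_)
open import Relation.Binary.Construct.Closure.ReflexiveTransitive using (Star)
open import Function.Definitions using (Injective)

record Graph : Set₁ where
  field
    V   : Set
    Adj : V → V → Set
open Graph public

-- The closure C_{k,n} of the complete n-ary tree T_{k,n} of depth k-1.
-- A vertex is the path from the root: a list of child indices of length < k
-- (root = []; children of s are s ++ [i]).  Ancestor = strict prefix.

CV : ℕ → ℕ → Set
CV k n = Σ[ s ∈ List (Fin n) ] (length s < k)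

StrictPrefix : ∀ {n} → List (Fin n) → List (Fin n) → Set
StrictPrefix s t = Σ[ u ∈ _ ] (0 < length u × t ≡ s ++ u)

C : ℕ → ℕ → Graph
C k n = record
  { V   = CV k n
  ; Adj = λ x y → StrictPrefix (proj₁ x) (proj₁ y) ⊎ StrictPrefix (proj₁ y) (proj₁ x)
  }

_⊠_ : Graph → Graph → Graph
A ⊠ B = record
  { V   = V A × V B
  ; Adj = λ { (v , x) (w , y) →
        ((v , x) ≢ (w , y)) ×
        ( (v ≡ w × Adj B x y)
        ⊎ (x ≡ y × Adj A v w)
        ⊎ (Adj A v w × Adj B x y)) }
  }

⊠C : ∀ {d} → Vec ℕ (suc d) → Vec ℕ (suc d) → Graph
⊠C (k ∷ []) (n ∷ []) = C k n
⊠C (k ∷ k' ∷ ks) (n ∷ n' ∷ ns) = C k n ⊠ ⊠C (k' ∷ ks) (n' ∷ ns)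

prodVec : ∀ {d} → Vec ℕ d → ℕ
prodVec [] = 1
prodVec (k ∷ ks) = k * prodVec ks

ColProp : Set₁
ColProp = (G : Graph) → ∀ {p} → (V G → Subset p) → Set

AtMost : ∀ {A : Set} → ℕ → (A → Set) → Set
AtMost {A} c P = ¬ (Σ[ f ∈ (Fin (suc c) → A) ] (Injective _≡_ _≡_ f × (∀ j → P (f j))))

MonoAdj : (G : Graph) → ∀ {p} → (V G → Subset p) → Fin p → V G → V G → Set
MonoAdj G col α x y = Adj G x y × α ∈ col x × α ∈ col y

Defect : ℕ → ColProp
Defect c G col = ∀ α v → α ∈ col v → AtMost c (λ w → MonoAdj G col α v w)

Clustering : ℕ → ColProp
Clustering c G col = ∀ α v → α ∈ col v → AtMost c (λ w → Star (MonoAdj G col α) v w)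

Proper : ColProp
Proper = Clustering 1

PQCol : Graph → ColProp → ℕ → ℕ → Set
PQCol G P p q = q ≤ p × Σ[ col ∈ (V G → Subset p) ] ((∀ v → ∣ col v ∣ ≡ q) × P G col)

KCol : Graph → ColProp → ℕ → Set
KCol G P k = PQCol G P k 1

-- fractional t-colouring with t = a/b (b ≥ 1): a (p:q)-colouring with p/q ≤ a/b
FracCol : Graph → ColProp → ℕ → ℕ → Set
FracCol G P a b = Σ[ p ∈ ℕ ] Σ[ q ∈ ℕ ] (1 ≤ q × p * b ≤ a * q × PQCol G P p q)

-- χ(𝒢) = K : sup over G of χ(G) = min{k : k-colourable properly}
ChiEq : {I : Set} → (I → Graph) → ℕ → Set
ChiEq F K =
  (∀ i → Σ[ k ∈ ℕ ] (k ≤ K × KCol (F i) Proper k)) ×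
  (Σ[ i ∈ _ ] (∀ k → k < K → ¬ KCol (F i) Proper k))

ChiParamEq : {I : Set} → (I → Graph) → (ℕ → ColProp) → ℕ → Set
ChiParamEq F P K =
  (Σ[ c ∈ ℕ ] (∀ i → KCol (F i) (P c) K)) ×
  (∀ k → k < K → ¬ (Σ[ c ∈ ℕ ] (∀ i → KCol (F i) (P c) k)))

-- infimum of {t : ∃ c, every graph has a fractional t-colouring with property P c}
-- equals K  (the set is upward closed; tested on rationals t = a/b)
FracParamEq : {I : Set} → (I → Graph) → (ℕ → ColProp) → ℕ → Set
FracParamEq F P K =
  (∀ a b → 1 ≤ b → K * b < a → Σ[ c ∈ ℕ ] (∀ i → FracCol (F i) (P c) a b)) ×
  (∀ a b → 1 ≤ b → a < K * b → ¬ (Σ[ c ∈ ℕ ] (∀ i → FracCol (F i) (P c) a b)))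

-- χ^f(𝒢) = K : sup over G of χ^f(G) = inf{t : G has a proper fractional t-colouring}
--   (∀ G, χ^f(G) ≤ K)  and  (∀ rational r < K, ∃ G with χ^f(G) > r)
FracChiEq : {I : Set} → (I → Graph) → ℕ → Set
FracChiEq F K =
  (∀ i a b → 1 ≤ b → K * b < a → FracCol (F i) Proper a b) ×
  (∀ a b → 1 ≤ b → a < K * b →
     Σ[ i ∈ _ ] Σ[ a' ∈ ℕ ] Σ[ b' ∈ ℕ ]
       (1 ≤ b' × a * b' < a' * b × ¬ FracCol (F i) Proper a' b'))

-- Upper bound: give each vertex of the product the tuple of the depths of its coordinates.
-- Adjacent vertices of C k n have different depths, and adjacent vertices of the product
-- are adjacent in some coordinate, so this is a proper colouring with ∏ kᵢ colours.
--
-- Lower bound: fix the defect c and m. By induction on the number of factors, n can be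
-- chosen so that every colouring with at most s colours per vertex and defect c has a
-- clique of size ∏ kᵢ carrying at most s/m monochromatic (colour, pair) incidences.
-- For C k n ⊠ H, walk down from the root of the tree, always entering a child whose
-- subtree receives few monochromatic edges from the current layer; since every vertex
-- has at most c monochromatic neighbours, averaging over the n children makes this
-- cost a 1/n fraction. The k layers of the path then colour H with pairs
-- (layer, colour), to which the induction hypothesis applies. For a (p:q)-colouring
-- the clique Q gives (∏ kᵢ)·q = Σ_α |Q ∩ α| ≤ p + q/m, so p/q ≥ ∏ kᵢ − 1/m, which
-- excludes every ratio below ∏ kᵢ once m is large.

module Submission where

open import Data.Bool using (Bool; true; false; _∧_)
open import Data.Empty using (⊥; ⊥-elim)
open import Data.Fin as Fin using (Fin; zero; suc)
open import Data.Fin.Properties using (toℕ-fromℕ<; combine-injective)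
open import Data.Fin.Subset using (Subset; ∣_∣; ⁅_⁆)
open import Data.Fin.Subset.Properties using (x∈⁅y⁆⇒x≡y; ∣⁅x⁆∣≡1)
open import Data.List using (List; []; _∷_; _++_; map; length; concatMap; cartesianProduct; deduplicate; allFin)
open import Data.List.Extrema.Nat using (argmin; f[argmin]≤f[xs])
open import Data.List.Membership.Propositional using (_∈_)
open import Data.List.Membership.Propositional.Properties
  using (∈-map⁺; ∈-map⁻; ∈-allFin; ∈-cartesianProduct⁺; ∈-cartesianProduct⁻; ∈-deduplicate⁺; ∈-concatMap⁺)
open import Data.List.Properties
  using ( length-++; length-map; length-tabulate; map-tabulate; ∷-injectiveˡ; ∷-injectiveʳ
        ; ++-identityʳ; ++-assoc; ++-cancelˡ; ≡-dec)
open import Data.List.Relation.Unary.All as ListAll using ([]; _∷_)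
open import Data.List.Relation.Unary.AllPairs as AllPairs using (AllPairs; []; _∷_)
open import Data.List.Relation.Unary.Any as Any using (here; there)
open import Data.List.Relation.Unary.Unique.Propositional using (Unique)
import Data.List.Relation.Unary.Unique.Propositional.Properties as Unique
open import Data.List.Relation.Unary.Unique.DecPropositional.Properties using (deduplicate-!)
open import Data.Nat using (ℕ; zero; suc; _+_; _*_; _≤_; _<_; z≤n; s≤s)
open import Data.Nat.Properties hiding (_≟_)
open import Data.Nat.Tactic.RingSolver using (solve-∀)
open import Data.Product using (Σ; Σ-syntax; _×_; _,_; proj₁; proj₂)
open import Data.Product.Properties using () renaming (≡-dec to ×-≡-dec)
open import Data.Sum using (_⊎_; inj₁; inj₂)
open import Data.Unit using (⊤; tt)
open import Data.Vec as Vec using (Vec; []; _∷_)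
open import Data.Vec.Properties using (lookup⇒[]=)
open import Data.Vec.Relation.Unary.All using (All; []; _∷_)
open import Function using (id; _∘_)
open import Function.Definitions using (Injective)
open import Relation.Binary.Construct.Closure.ReflexiveTransitive using (Star; ε; _◅_)
open import Relation.Binary.Definitions using (DecidableEquality)
open import Relation.Binary.PropositionalEquality
open import Relation.Nullary using (¬_; Dec; yes; no; does)
open import Relation.Nullary.Decidable using (_×-dec_; _⊎-dec_; ¬?; dec-true)

open import Defs

∑ : {A : Set} → List A → (A → ℕ) → ℕ
∑ []       f = 0
∑ (x ∷ xs) f = f x + ∑ xs f

syntax ∑ L (λ x → e) = ∑[ x ∈ L ] e

module _ {A : Set} where

  ∑-cong : ∀ (L : List A) {f g : A → ℕ} → (∀ x → x ∈ L → f x ≡ g x) → ∑ L f ≡ ∑ L g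
  ∑-cong []      h = refl
  ∑-cong (x ∷ L) h = cong₂ _+_ (h x (here refl)) (∑-cong L (λ y y∈ → h y (there y∈)))

  ∑-mono-≤ : ∀ (L : List A) {f g : A → ℕ} → (∀ x → x ∈ L → f x ≤ g x) → ∑ L f ≤ ∑ L g
  ∑-mono-≤ []      h = z≤n
  ∑-mono-≤ (x ∷ L) h = +-mono-≤ (h x (here refl)) (∑-mono-≤ L (λ y y∈ → h y (there y∈)))

  ∑-zero : ∀ (L : List A) → ∑[ _ ∈ L ] 0 ≡ 0
  ∑-zero []      = refl
  ∑-zero (_ ∷ L) = ∑-zero L

  ∑-const : ∀ (L : List A) {f : A → ℕ} {c} → (∀ x → x ∈ L → f x ≡ c) → ∑ L f ≡ length L * c
  ∑-const []      h = refl
  ∑-const (x ∷ L) h = cong₂ _+_ (h x (here refl)) (∑-const L (λ y y∈ → h y (there y∈)))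

  ∑-≤-const : ∀ (L : List A) {f : A → ℕ} {c} → (∀ x → x ∈ L → f x ≤ c) → ∑ L f ≤ length L * c
  ∑-≤-const []      h = z≤n
  ∑-≤-const (x ∷ L) h = +-mono-≤ (h x (here refl)) (∑-≤-const L (λ y y∈ → h y (there y∈)))

  ∑-≥-const : ∀ (L : List A) {f : A → ℕ} {c} → (∀ x → x ∈ L → c ≤ f x) → length L * c ≤ ∑ L f
  ∑-≥-const []      h = z≤n
  ∑-≥-const (x ∷ L) h = +-mono-≤ (h x (here refl)) (∑-≥-const L (λ y y∈ → h y (there y∈)))

  ∑-distrib-+ : ∀ (L : List A) (f g : A → ℕ) → ∑[ x ∈ L ] (f x + g x) ≡ ∑ L f + ∑ L g
  ∑-distrib-+ []      f g = refl
  ∑-distrib-+ (x ∷ L) f g =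
    trans (cong (f x + g x +_) (∑-distrib-+ L f g)) (lemma (f x) (g x) (∑ L f) (∑ L g))
    where
    lemma : ∀ a b c d → a + b + (c + d) ≡ a + c + (b + d)
    lemma = solve-∀

  ∑-*ˡ : ∀ (L : List A) a (f : A → ℕ) → ∑[ x ∈ L ] (a * f x) ≡ a * ∑ L f
  ∑-*ˡ []      a f = sym (*-zeroʳ a)
  ∑-*ˡ (x ∷ L) a f = trans (cong (a * f x +_) (∑-*ˡ L a f)) (sym (*-distribˡ-+ a (f x) (∑ L f)))

  ∑-*ʳ : ∀ (L : List A) a (f : A → ℕ) → ∑[ x ∈ L ] (f x * a) ≡ ∑ L f * a
  ∑-*ʳ L a f = trans (∑-cong L (λ x _ → *-comm (f x) a)) (trans (∑-*ˡ L a f) (*-comm a (∑ L f)))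

  ∑-++ : ∀ (L M : List A) (f : A → ℕ) → ∑ (L ++ M) f ≡ ∑ L f + ∑ M f
  ∑-++ []      M f = refl
  ∑-++ (x ∷ L) M f = trans (cong (f x +_) (∑-++ L M f)) (sym (+-assoc (f x) (∑ L f) (∑ M f)))

  ∑-length : ∀ (L : List A) → ∑[ _ ∈ L ] 1 ≡ length L
  ∑-length L = trans (∑-const L (λ _ _ → refl)) (*-identityʳ (length L))

∑-map : {A B : Set} (g : A → B) (L : List A) (f : B → ℕ) → ∑ (map g L) f ≡ ∑[ x ∈ L ] f (g x)
∑-map g []      f = refl
∑-map g (x ∷ L) f = cong (f (g x) +_) (∑-map g L f)

module _ {A B : Set} where

  ∑-comm : ∀ (L : List A) (M : List B) (f : A → B → ℕ) →
    ∑[ x ∈ L ] ∑[ y ∈ M ] f x y ≡ ∑[ y ∈ M ] ∑[ x ∈ L ] f x y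
  ∑-comm []      M f = sym (∑-zero M)
  ∑-comm (x ∷ L) M f =
    trans (cong (∑ M (f x) +_) (∑-comm L M f)) (sym (∑-distrib-+ M (f x) (λ y → ∑[ x ∈ L ] f x y)))

  ∑-cartesianProduct : ∀ (L : List A) (M : List B) (f : A × B → ℕ) →
    ∑ (cartesianProduct L M) f ≡ ∑[ x ∈ L ] ∑[ y ∈ M ] f (x , y)
  ∑-cartesianProduct []      M f = refl
  ∑-cartesianProduct (x ∷ L) M f = trans (∑-++ (map (x ,_) M) (cartesianProduct L M) f)
    (cong₂ _+_ (∑-map (x ,_) M f) (∑-cartesianProduct L M f))

∑-⊆ : {A : Set} (L M : List A) (f : A → ℕ) → Unique L → (∀ x → x ∈ L → x ∈ M) → ∑ L f ≤ ∑ M f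
∑-⊆ []      M f _          _   = z≤n
∑-⊆ (x ∷ L) M f (x∉L ∷ uL) L⊆M = begin
  f x + ∑ L f                   ≤⟨ +-monoʳ-≤ (f x) (∑-⊆ L (remove M x∈M) f uL L⊆M-x) ⟩
  f x + ∑ (remove M x∈M) f      ≡⟨ ∑-remove M x∈M ⟨
  ∑ M f                         ∎
  where
  open ≤-Reasoning
  x∈M = L⊆M x (here refl)
  remove : ∀ {y} (N : List _) → y ∈ N → List _
  remove (_ ∷ N) (here _)  = N
  remove (z ∷ N) (there p) = z ∷ remove N p
  ∑-remove : ∀ {y} (N : List _) (p : y ∈ N) → ∑ N f ≡ f y + ∑ (remove N p) f
  ∑-remove (_ ∷ N) (here refl) = refl
  ∑-remove {y} (z ∷ N) (there p) = trans (cong (f z +_) (∑-remove N p)) (lemma (f z) (f y) _)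
    where
    lemma : ∀ a b c → a + (b + c) ≡ b + (a + c)
    lemma = solve-∀
  ∈-remove : ∀ {y z} (N : List _) (p : y ∈ N) → z ∈ N → z ≢ y → z ∈ remove N p
  ∈-remove (_ ∷ N) (here refl) (here refl) z≢y = ⊥-elim (z≢y refl)
  ∈-remove (_ ∷ N) (here refl) (there q)   _   = q
  ∈-remove (_ ∷ N) (there p)   (here refl) _   = here refl
  ∈-remove (_ ∷ N) (there p)   (there q)   z≢y = there (∈-remove N p q z≢y)
  L⊆M-x : ∀ z → z ∈ L → z ∈ remove M x∈M
  L⊆M-x z z∈L = ∈-remove M x∈M (L⊆M z (there z∈L)) (λ z≡x → ListAll.lookup x∉L z∈L (sym z≡x))

∃-below-average : ∀ n (f : Fin (suc n) → ℕ) → Σ[ x ∈ Fin (suc n) ] (suc n * f x ≤ ∑ (allFin (suc n)) f)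
∃-below-average n f = x , subst (λ l → l * f x ≤ ∑ (allFin (suc n)) f) (length-tabulate {n = suc n} id)
  (∑-≥-const (allFin (suc n)) (λ y y∈ → ListAll.lookup (f[argmin]≤f[xs] {f = f} zero (allFin (suc n))) y∈))
  where x = argmin f zero (allFin (suc n))

𝟙 : Bool → ℕ
𝟙 true  = 1
𝟙 false = 0

AtMost-remove : ∀ {A : Set} {P : A → Set} {c a} → AtMost (suc c) P → P a → AtMost c (λ w → P w × w ≢ a)
AtMost-remove {A} {P} {c} {a} ≤suc-c Pa (f , f-inj , Pf) = ≤suc-c (g , g-inj , Pg)
  where
  g : Fin (suc (suc c)) → A
  g zero    = a
  g (suc j) = f j
  g-inj : Injective _≡_ _≡_ g
  g-inj {zero}  {zero}  _ = refl
  g-inj {zero}  {suc j} e = ⊥-elim (proj₂ (Pf j) (sym e))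
  g-inj {suc i} {zero}  e = ⊥-elim (proj₂ (Pf i) e)
  g-inj {suc i} {suc j} e = cong suc (f-inj e)
  Pg : ∀ j → P (g j)
  Pg zero    = Pa
  Pg (suc j) = proj₁ (Pf j)

∑𝟙-≤-AtMost : ∀ {A : Set} (b : A → Bool) (L : List A) {P : A → Set} c → Unique L →
  (∀ x → x ∈ L → b x ≡ true → P x) → AtMost c P → ∑[ x ∈ L ] 𝟙 (b x) ≤ c
∑𝟙-≤-AtMost b []      c _ _ _ = z≤n
∑𝟙-≤-AtMost b (a ∷ L) c (a∉L ∷ uL) b⇒P ≤c with b a in ba
... | false = ∑𝟙-≤-AtMost b L c uL (λ x x∈ → b⇒P x (there x∈)) ≤c
∑𝟙-≤-AtMost b (a ∷ L) zero (a∉L ∷ uL) b⇒P ≤0 | true =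
  ⊥-elim (≤0 ((λ _ → a) , (λ { {zero} {zero} _ → refl }) , (λ _ → b⇒P a (here refl) ba)))
∑𝟙-≤-AtMost b (a ∷ L) (suc c) (a∉L ∷ uL) b⇒P ≤suc-c | true =
  s≤s (∑𝟙-≤-AtMost b L c uL
        (λ x x∈ bx → b⇒P x (there x∈) bx , λ x≡a → ListAll.lookup a∉L x∈ (sym x≡a))
        (AtMost-remove ≤suc-c (b⇒P a (here refl) ba)))

∑𝟙-≤-1 : ∀ {A : Set} (b : A → Bool) (L : List A) → Unique L →
  (∀ x y → b x ≡ true → b y ≡ true → x ≡ y) → ∑[ x ∈ L ] 𝟙 (b x) ≤ 1
∑𝟙-≤-1 b L uL unique = ∑𝟙-≤-AtMost b L 1 uL (λ _ _ bx → bx)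
  λ (f , f-inj , bf) → 0≢1 (f-inj (unique (f zero) (f (suc zero)) (bf zero) (bf (suc zero))))
  where
  0≢1 : zero ≢ Fin.suc {1} zero
  0≢1 ()

record Finite (G : Graph) : Set where
  field
    vertices        : List (V G)
    ∈-vertices      : ∀ v → v ∈ vertices
    vertices-unique : Unique vertices
    _≟_             : DecidableEquality (V G)
    adjacent?       : ∀ u w → Dec (Adj G u w)
    irreflexive     : ∀ u → ¬ Adj G u u
open Finite

Prefix : ∀ {n} → List (Fin n) → List (Fin n) → Set
Prefix s t = Σ[ u ∈ List _ ] (t ≡ s ++ u)

module _ {n : ℕ} where

  StrictPrefix⇒length-< : {s t : List (Fin n)} → StrictPrefix s t → length s < length t
  StrictPrefix⇒length-< {s} (u , 0<∣u∣ , refl) =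
    subst (length s <_) (sym (length-++ s)) (subst (_≤ length s + length u) (+-comm (length s) 1) (+-monoʳ-≤ (length s) 0<∣u∣))

  StrictPrefix-irrefl : (s : List (Fin n)) → ¬ StrictPrefix s s
  StrictPrefix-irrefl s sp = <-irrefl refl (StrictPrefix⇒length-< sp)

  StrictPrefix? : (s t : List (Fin n)) → Dec (StrictPrefix s t)
  StrictPrefix? []      []      = no λ { ([] , () , _) ; (_ ∷ _ , _ , ()) }
  StrictPrefix? []      (b ∷ t) = yes (b ∷ t , s≤s z≤n , refl)
  StrictPrefix? (a ∷ s) []      = no λ { (_ , _ , ()) }
  StrictPrefix? (a ∷ s) (b ∷ t) with a Fin.≟ b | StrictPrefix? s t
  ... | no a≢b   | _                   = no λ { (_ , _ , e) → a≢b (sym (∷-injectiveˡ e)) }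
  ... | yes refl | yes (u , 0<∣u∣ , e) = yes (u , 0<∣u∣ , cong (a ∷_) e)
  ... | yes refl | no ¬sp              = no λ { (u , 0<∣u∣ , e) → ¬sp (u , 0<∣u∣ , ∷-injectiveʳ e) }

  Prefix? : (s t : List (Fin n)) → Dec (Prefix s t)
  Prefix? []      t       = yes (t , refl)
  Prefix? (a ∷ s) []      = no λ { (_ , ()) }
  Prefix? (a ∷ s) (b ∷ t) with a Fin.≟ b | Prefix? s t
  ... | no a≢b   | _            = no λ { (_ , e) → a≢b (sym (∷-injectiveˡ e)) }
  ... | yes refl | yes (u , e)  = yes (u , cong (a ∷_) e)
  ... | yes refl | no ¬p        = no λ { (u , e) → ¬p (u , ∷-injectiveʳ e) }

  Prefix-refl : (s : List (Fin n)) → Prefix s s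
  Prefix-refl s = [] , sym (++-identityʳ s)

  Prefix-trans : {s t r : List (Fin n)} → Prefix s t → Prefix t r → Prefix s r
  Prefix-trans {s} (u , refl) (v , refl) = u ++ v , ++-assoc s u v

  Prefix-child⇒StrictPrefix : (s : List (Fin n)) (x : Fin n) {t : List (Fin n)} →
    Prefix (s ++ x ∷ []) t → StrictPrefix s t
  Prefix-child⇒StrictPrefix s x (u , refl) = x ∷ u , s≤s z≤n , ++-assoc s (x ∷ []) u

  Prefix-child-unique : (s : List (Fin n)) (x y : Fin n) {t : List (Fin n)} →
    Prefix (s ++ x ∷ []) t → Prefix (s ++ y ∷ []) t → x ≡ y
  Prefix-child-unique s x y (u , t≡sxu) (v , t≡syv) = ∷-injectiveˡ (++-cancelˡ s (x ∷ u) (y ∷ v) (begin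
    s ++ x ∷ u        ≡⟨ ++-assoc s (x ∷ []) u ⟨
    (s ++ x ∷ []) ++ u ≡⟨ trans (sym t≡sxu) t≡syv ⟩
    (s ++ y ∷ []) ++ v ≡⟨ ++-assoc s (y ∷ []) v ⟩
    s ++ y ∷ v        ∎))
    where open ≡-Reasoning

  pathsOfLength≤ : ∀ l → List (Σ[ s ∈ List (Fin n) ] (length s ≤ l))
  pathsOfLength≤ zero    = ([] , z≤n) ∷ []
  pathsOfLength≤ (suc l) = ([] , z≤n) ∷ concatMap (λ x → map (extend x) (pathsOfLength≤ l)) (allFin n)
    where
    extend : Fin n → Σ[ s ∈ List (Fin n) ] (length s ≤ l) → Σ[ s ∈ List (Fin n) ] (length s ≤ suc l)
    extend x (s , ∣s∣≤l) = x ∷ s , s≤s ∣s∣≤l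

  ∈-pathsOfLength≤ : ∀ l s (∣s∣≤l : length s ≤ l) → (s , ∣s∣≤l) ∈ pathsOfLength≤ l
  ∈-pathsOfLength≤ zero    []      z≤n = here refl
  ∈-pathsOfLength≤ (suc l) []      z≤n = here refl
  ∈-pathsOfLength≤ (suc l) (x ∷ s) (s≤s ∣s∣≤l) = there (∈-concatMap⁺ _
    (Any.map (λ { refl → ∈-map⁺ _ (∈-pathsOfLength≤ l s ∣s∣≤l) }) (∈-allFin x)))

  CV-≟ : ∀ {k} → DecidableEquality (CV k n)
  CV-≟ (s , p) (t , q) with ≡-dec Fin._≟_ s t
  ... | yes refl = yes (cong (s ,_) (<-irrelevant p q))
  ... | no s≢t   = no λ e → s≢t (cong proj₁ e)

  enumerateCV : ∀ k → List (CV k n)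
  enumerateCV zero    = []
  enumerateCV (suc k) = map (λ (s , ∣s∣≤k) → s , s≤s ∣s∣≤k) (pathsOfLength≤ k)

  ∈-enumerateCV : ∀ k (v : CV k n) → v ∈ enumerateCV k
  ∈-enumerateCV (suc k) (s , s≤s ∣s∣≤k) = ∈-map⁺ _ (∈-pathsOfLength≤ k s ∣s∣≤k)

finite-C : ∀ k n → Finite (C k n)
finite-C k n = record
  { vertices        = deduplicate CV-≟ (enumerateCV k)
  ; ∈-vertices      = λ v → ∈-deduplicate⁺ CV-≟ (∈-enumerateCV k v)
  ; vertices-unique = deduplicate-! CV-≟ (enumerateCV k)
  ; _≟_             = CV-≟
  ; adjacent?       = λ u w → StrictPrefix? (proj₁ u) (proj₁ w) ⊎-dec StrictPrefix? (proj₁ w) (proj₁ u)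
  ; irreflexive     = λ { u (inj₁ sp) → StrictPrefix-irrefl (proj₁ u) sp ; u (inj₂ sp) → StrictPrefix-irrefl (proj₁ u) sp }
  }

finite-⊠ : ∀ {A B : Graph} → Finite A → Finite B → Finite (A ⊠ B)
finite-⊠ {A} {B} FA FB = record
  { vertices        = cartesianProduct (vertices FA) (vertices FB)
  ; ∈-vertices      = λ (v , x) → ∈-cartesianProduct⁺ (∈-vertices FA v) (∈-vertices FB x)
  ; vertices-unique = Unique.cartesianProduct⁺ (vertices-unique FA) (vertices-unique FB)
  ; _≟_             = _≟×_
  ; adjacent?       = λ (v , x) (w , y) → ¬? ((v , x) ≟× (w , y)) ×-dec
      ((_≟_ FA v w ×-dec adjacent? FB x y) ⊎-dec
       ((_≟_ FB x y ×-dec adjacent? FA v w) ⊎-dec (adjacent? FA v w ×-dec adjacent? FB x y)))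
  ; irreflexive     = λ _ (u≢u , _) → u≢u refl
  }
  where
  _≟×_ : DecidableEquality (V A × V B)
  _≟×_ = ×-≡-dec (_≟_ FA) (_≟_ FB)

UnitGraph : Graph
UnitGraph = record { V = ⊤ ; Adj = λ _ _ → ⊥ }

finite-UnitGraph : Finite UnitGraph
finite-UnitGraph = record
  { vertices        = tt ∷ []
  ; ∈-vertices      = λ _ → here refl
  ; vertices-unique = [] ∷ []
  ; _≟_             = λ _ _ → yes refl
  ; adjacent?       = λ _ _ → no λ ()
  ; irreflexive     = λ _ ()
  }

finite-⊠C : ∀ {d} (ks ns : Vec ℕ (suc d)) → Finite (⊠C ks ns)
finite-⊠C (k ∷ [])      (n ∷ [])      = finite-C k n
finite-⊠C (k ∷ k' ∷ ks) (n ∷ n' ∷ ns) = finite-⊠ (finite-C k n) (finite-⊠C (k' ∷ ks) (n' ∷ ns))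

IsClique : (G : Graph) → List (V G) → Set
IsClique G Q = ∀ {u w} → u ∈ Q → w ∈ Q → u ≡ w ⊎ Adj G u w

length-cartesianProduct : {A B : Set} (L : List A) (M : List B) →
  length (cartesianProduct L M) ≡ length L * length M
length-cartesianProduct []      M = refl
length-cartesianProduct (x ∷ L) M = trans (length-++ (map (x ,_) M))
  (cong₂ _+_ (length-map (x ,_) M) (length-cartesianProduct L M))

IsClique-cartesianProduct : ∀ {A B : Graph} {L M} → (∀ v → ¬ Adj A v v) → (∀ x → ¬ Adj B x x) →
  IsClique A L → IsClique B M → IsClique (A ⊠ B) (cartesianProduct L M)
IsClique-cartesianProduct {A} {B} {L} {M} irrA irrB cliqueL cliqueM {v , x} {w , y} vx∈ wy∈
  with ∈-cartesianProduct⁻ L M vx∈ | ∈-cartesianProduct⁻ L M wy∈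
... | v∈ , x∈ | w∈ , y∈ with cliqueL v∈ w∈ | cliqueM x∈ y∈
...   | inj₁ refl | inj₁ refl = inj₁ refl
...   | inj₁ refl | inj₂ x~y  = inj₂ ((λ e → irrB x (subst (Adj B x) (sym (cong proj₂ e)) x~y)) , inj₁ (refl , x~y))
...   | inj₂ v~w  | inj₁ refl = inj₂ ((λ e → irrA v (subst (Adj A v) (sym (cong proj₁ e)) v~w)) , inj₂ (inj₁ (refl , v~w)))
...   | inj₂ v~w  | inj₂ x~y  = inj₂ ((λ e → irrA v (subst (Adj A v) (sym (cong proj₁ e)) v~w)) , inj₂ (inj₂ (v~w , x~y)))

module _ {k n : ℕ} where

  AllBelow : List (Fin n) → List (CV k n) → Set
  AllBelow s = ListAll.All (λ u → Prefix s (proj₁ u))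

  StrictPrefixᶜ : CV k n → CV k n → Set
  StrictPrefixᶜ a b = StrictPrefix (proj₁ a) (proj₁ b)

  IsClique-C : {ch : List (CV k n)} → AllPairs StrictPrefixᶜ ch → IsClique (C k n) ch
  IsClique-C (sp ∷ _)  (here refl) (here refl) = inj₁ refl
  IsClique-C (sp ∷ _)  (here refl) (there b∈)  = inj₂ (inj₁ (ListAll.lookup sp b∈))
  IsClique-C (sp ∷ _)  (there a∈)  (here refl) = inj₂ (inj₂ (ListAll.lookup sp a∈))
  IsClique-C (_  ∷ ch) (there a∈)  (there b∈)  = IsClique-C ch a∈ b∈

  Unique-C : {ch : List (CV k n)} → AllPairs StrictPrefixᶜ ch → Unique ch
  Unique-C = AllPairs.map λ {a} sp a≡b → StrictPrefix-irrefl (proj₁ a) (subst (StrictPrefixᶜ a) (sym a≡b) sp)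

Colouring : Graph → Set → Set
Colouring G P = V G → P → Bool

Defective : ℕ → (G : Graph) → ∀ {P} → Colouring G P → Set
Defective c G col = ∀ π v → col v π ≡ true → AtMost c (λ w → Adj G v w × col w π ≡ true)

module _ {A P : Set} where

  count : (A → P → Bool) → P → List A → ℕ
  count col π Q = ∑[ u ∈ Q ] 𝟙 (col u π)

  monoPairs : (A → P → Bool) → P → List A → ℕ
  monoPairs col π []      = 0
  monoPairs col π (u ∷ Q) = 𝟙 (col u π) * count col π Q + monoPairs col π Q

  clash : List P → (A → P → Bool) → List A → ℕ
  clash Ps col Q = ∑[ π ∈ Ps ] monoPairs col π Q

  load : List P → (A → P → Bool) → A → ℕ
  load Ps col v = ∑[ π ∈ Ps ] 𝟙 (col v π)

  count-≤-1+monoPairs : ∀ col π (Q : List A) → count col π Q ≤ 1 + monoPairs col π Q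
  count-≤-1+monoPairs col π []      = z≤n
  count-≤-1+monoPairs col π (u ∷ Q) with col u π
  ... | false = count-≤-1+monoPairs col π Q
  ... | true  = s≤s (≤-trans (≤-reflexive (sym (*-identityˡ (count col π Q)))) (m≤m+n _ _))

  monoPairs-++ : ∀ col π (L M : List A) →
    monoPairs col π (L ++ M) ≡ monoPairs col π L + monoPairs col π M + count col π L * count col π M
  monoPairs-++ col π []      M = sym (+-identityʳ (monoPairs col π M))
  monoPairs-++ col π (u ∷ L) M
    rewrite ∑-++ L M (λ u → 𝟙 (col u π)) | monoPairs-++ col π L M =
    lemma (𝟙 (col u π)) (count col π L) (count col π M) (monoPairs col π L) (monoPairs col π M)
    where
    lemma : ∀ a b c d e → a * (b + c) + (d + e + b * c) ≡ a * b + d + e + (a + b) * c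
    lemma = solve-∀

monoPairs-map : ∀ {A B P : Set} (col : B → P → Bool) π (f : A → B) (L : List A) →
  monoPairs col π (map f L) ≡ monoPairs (col ∘ f) π L
monoPairs-map col π f []      = refl
monoPairs-map col π f (u ∷ L) =
  cong₂ (λ a b → 𝟙 (col (f u) π) * a + b) (∑-map f L (λ v → 𝟙 (col v π))) (monoPairs-map col π f L)

monoPairs-cong : ∀ {A P P' : Set} (col : A → P → Bool) (col' : A → P' → Bool) π π' (L : List A) →
  (∀ u → col u π ≡ col' u π') → monoPairs col π L ≡ monoPairs col' π' L
monoPairs-cong col col' π π' []      same = refl
monoPairs-cong col col' π π' (u ∷ L) same = cong₂ (λ a b → a + b)
  (cong₂ _*_ (cong 𝟙 (same u)) (∑-cong L (λ v _ → cong 𝟙 (same v))))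
  (monoPairs-cong col col' π π' L same)

module _ {A B P : Set} (col : A × B → P → Bool) where

  layerColouring : B → A × P → Bool
  layerColouring y (g , π) = col (g , y) π

  crossPairs : P → List A → List B → ℕ
  crossPairs π []      M = 0
  crossPairs π (g ∷ L) M = count col π (map (g ,_) M) * count col π (cartesianProduct L M) + crossPairs π L M

  monoPairs-cartesianProduct : ∀ π (L : List A) (M : List B) →
    monoPairs col π (cartesianProduct L M) ≡ ∑[ g ∈ L ] monoPairs layerColouring (g , π) M + crossPairs π L M
  monoPairs-cartesianProduct π []      M = refl
  monoPairs-cartesianProduct π (g ∷ L) M = begin
    monoPairs col π (layer ++ rest)
      ≡⟨ monoPairs-++ col π layer rest ⟩
    monoPairs col π layer + monoPairs col π rest + count col π layer * count col π rest
      ≡⟨ cong₂ (λ a b → a + b + count col π layer * count col π rest)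
           (trans (monoPairs-map col π (g ,_) M) (monoPairs-cong (col ∘ (g ,_)) layerColouring π (g , π) M (λ _ → refl)))
           (monoPairs-cartesianProduct π L M) ⟩
    monoPairs layerColouring (g , π) M + (∑[ h ∈ L ] monoPairs layerColouring (h , π) M + crossPairs π L M)
      + count col π layer * count col π rest
      ≡⟨ lemma (monoPairs layerColouring (g , π) M) _ (crossPairs π L M) _ ⟩
    monoPairs layerColouring (g , π) M + ∑[ h ∈ L ] monoPairs layerColouring (h , π) M
      + (count col π layer * count col π rest + crossPairs π L M) ∎
    where
    open ≡-Reasoning
    layer = map (g ,_) M
    rest  = cartesianProduct L M
    lemma : ∀ a b d e → a + (b + d) + e ≡ a + b + (e + d)
    lemma = solve-∀

  clash-cartesianProduct : ∀ (Ps : List P) (L : List A) (M : List B) →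
    clash Ps col (cartesianProduct L M) ≡ clash (cartesianProduct L Ps) layerColouring M + ∑[ π ∈ Ps ] crossPairs π L M
  clash-cartesianProduct Ps L M = begin
    ∑[ π ∈ Ps ] monoPairs col π (cartesianProduct L M)
      ≡⟨ ∑-cong Ps (λ π _ → monoPairs-cartesianProduct π L M) ⟩
    ∑[ π ∈ Ps ] (∑[ g ∈ L ] monoPairs layerColouring (g , π) M + crossPairs π L M)
      ≡⟨ ∑-distrib-+ Ps _ _ ⟩
    ∑[ π ∈ Ps ] ∑[ g ∈ L ] monoPairs layerColouring (g , π) M + ∑[ π ∈ Ps ] crossPairs π L M
      ≡⟨ cong (_+ ∑[ π ∈ Ps ] crossPairs π L M) (∑-comm Ps L _) ⟩
    ∑[ g ∈ L ] ∑[ π ∈ Ps ] monoPairs layerColouring (g , π) M + ∑[ π ∈ Ps ] crossPairs π L M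
      ≡⟨ cong (_+ ∑[ π ∈ Ps ] crossPairs π L M) (∑-cartesianProduct L Ps (λ gπ → monoPairs layerColouring gπ M)) ⟨
    clash (cartesianProduct L Ps) layerColouring M + ∑[ π ∈ Ps ] crossPairs π L M ∎
    where open ≡-Reasoning

SparseCliques : Graph → ℕ → ℕ → ℕ → Set₁
SparseCliques G K c m = ∀ (P : Set) (Ps : List P) s (col : Colouring G P) →
  (∀ v → load Ps col v ≤ s) → Defective c G col →
  Σ[ Q ∈ List (V G) ] (length Q ≡ K × Unique Q × IsClique G Q × m * clash Ps col Q ≤ s)

does-true : ∀ {A : Set} (a? : Dec A) → does a? ≡ true → A
does-true (yes a) _ = a

∧-true : ∀ {a b} → a ∧ b ≡ true → a ≡ true × b ≡ true
∧-true {true} b≡true = refl , b≡true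

module _ {k n : ℕ} {H : Graph} where

  StrictPrefix⇒≢ : ∀ {g g' : CV k n} {y y' : V H} → StrictPrefix (proj₁ g) (proj₁ g') → (g , y) ≢ (g' , y')
  StrictPrefix⇒≢ {g} sp e = StrictPrefix-irrefl (proj₁ g) (subst (StrictPrefix (proj₁ g)) (sym (cong (proj₁ ∘ proj₁) e)) sp)

  StrictPrefix⇒Adj-⊠ : ∀ {g g' y y'} → StrictPrefix (proj₁ g) (proj₁ g') → y ≡ y' ⊎ Adj H y y' →
    Adj (C k n ⊠ H) (g , y) (g' , y')
  StrictPrefix⇒Adj-⊠ sp (inj₁ refl) = StrictPrefix⇒≢ sp , inj₂ (inj₁ (refl , inj₁ sp))
  StrictPrefix⇒Adj-⊠ sp (inj₂ y~y') = StrictPrefix⇒≢ sp , inj₂ (inj₂ (inj₁ sp , y~y'))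

module _ {k n : ℕ} (Good : CV k n → Fin n → Set) where

  GoodChain : List (CV k n) → Set
  GoodChain []       = ⊤
  GoodChain (g ∷ ch) = (Σ[ x ∈ Fin n ] (Good g x × AllBelow (proj₁ g ++ x ∷ []) ch)) × GoodChain ch

  GoodChain⇒AllPairs : ∀ {ch} → GoodChain ch → AllPairs StrictPrefixᶜ ch
  GoodChain⇒AllPairs {[]}     _                       = []
  GoodChain⇒AllPairs {g ∷ ch} ((x , _ , below) , rest) =
    ListAll.map (Prefix-child⇒StrictPrefix (proj₁ g) x) below ∷ GoodChain⇒AllPairs rest

  greedyChain : (∀ g → Σ[ x ∈ Fin n ] Good g x) → Σ[ ch ∈ List (CV k n) ] (length ch ≡ k × GoodChain ch)
  greedyChain choose = let ch , len , good , _ = descend k [] refl in ch , len , good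
    where
    descend : ∀ ρ (s : List (Fin n)) → length s + ρ ≡ k →
      Σ[ ch ∈ List (CV k n) ] (length ch ≡ ρ × GoodChain ch × AllBelow s ch)
    descend zero    s _ = [] , refl , tt , []
    descend (suc ρ) s ∣s∣+1+ρ≡k =
      let ∣s∣<k = subst (length s <_) ∣s∣+1+ρ≡k (m<m+n (length s) (s≤s z≤n))
          x , good = choose (s , ∣s∣<k)
          ∣sx∣+ρ≡k = trans (cong (_+ ρ) (length-++ s)) (trans (+-assoc (length s) 1 ρ) ∣s∣+1+ρ≡k)
          ch , len , rest , below = descend ρ (s ++ x ∷ []) ∣sx∣+ρ≡k
      in (s , ∣s∣<k) ∷ ch , cong suc len , ((x , good , below) , rest) ,
         Prefix-refl s ∷ ListAll.map (Prefix-trans (x ∷ [] , refl)) below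

module LightChain (k n' : ℕ) {H : Graph} (FH : Finite H) {P : Set} (Ps : List P) (s c : ℕ)
  (col : Colouring (C k (suc n') ⊠ H) P)
  (load≤s : ∀ v → load Ps col v ≤ s) (defective : Defective c (C k (suc n') ⊠ H) col) where

  n : ℕ
  n = suc n'

  FGH : Finite (C k n ⊠ H)
  FGH = finite-⊠ (finite-C k n) FH

  VH : List (V H)
  VH = vertices FH

  VGH : List (V (C k n ⊠ H))
  VGH = vertices FGH

  inSubtree : List (Fin n) → Fin n → V (C k n ⊠ H) → Bool
  inSubtree g x w = does (Prefix? (g ++ x ∷ []) (proj₁ (proj₁ w)))

  subtreeDegree : CV k n → Fin n → V H → P → ℕ
  subtreeDegree g x y π = ∑[ w ∈ VGH ] (𝟙 (inSubtree (proj₁ g) x w) * 𝟙 (does (adjacent? FGH (g , y) w) ∧ col w π))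

  subtreeLoad : CV k n → Fin n → ℕ
  subtreeLoad g x = ∑[ π ∈ Ps ] ∑[ y ∈ VH ] (𝟙 (col (g , y) π) * subtreeDegree g x y π)

  ∑-subtreeDegree : ∀ g y π → col (g , y) π ≡ true → ∑[ x ∈ allFin n ] subtreeDegree g x y π ≤ c
  ∑-subtreeDegree g y π coloured = begin
    ∑[ x ∈ allFin n ] ∑[ w ∈ VGH ] (below x w * neighbour w)
      ≡⟨ ∑-comm (allFin n) VGH _ ⟩
    ∑[ w ∈ VGH ] ∑[ x ∈ allFin n ] (below x w * neighbour w)
      ≡⟨ ∑-cong VGH (λ w _ → ∑-*ʳ (allFin n) (neighbour w) (λ x → below x w)) ⟩
    ∑[ w ∈ VGH ] (∑[ x ∈ allFin n ] below x w * neighbour w)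
      ≤⟨ ∑-mono-≤ VGH (λ w _ → *-monoˡ-≤ (neighbour w) (in-at-most-one-subtree w)) ⟩
    ∑[ w ∈ VGH ] (1 * neighbour w)
      ≡⟨ ∑-cong VGH (λ w _ → *-identityˡ (neighbour w)) ⟩
    ∑[ w ∈ VGH ] neighbour w
      ≤⟨ ∑𝟙-≤-AtMost _ VGH c (vertices-unique FGH) monochromatic-neighbour (defective π (g , y) coloured) ⟩
    c ∎
    where
    open ≤-Reasoning
    below : Fin n → V (C k n ⊠ H) → ℕ
    below x w = 𝟙 (inSubtree (proj₁ g) x w)
    neighbour : V (C k n ⊠ H) → ℕ
    neighbour w = 𝟙 (does (adjacent? FGH (g , y) w) ∧ col w π)
    in-at-most-one-subtree : ∀ w → ∑[ x ∈ allFin n ] below x w ≤ 1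
    in-at-most-one-subtree w = ∑𝟙-≤-1 (λ x → inSubtree (proj₁ g) x w) (allFin n) (Unique.allFin⁺ n)
      λ x x' in-x in-x' → Prefix-child-unique (proj₁ g) x x' (does-true (Prefix? _ _) in-x) (does-true (Prefix? _ _) in-x')
    monochromatic-neighbour : ∀ w → w ∈ VGH → (does (adjacent? FGH (g , y) w) ∧ col w π) ≡ true →
      Adj (C k n ⊠ H) (g , y) w × col w π ≡ true
    monochromatic-neighbour w _ e = let adj , mono = ∧-true e in does-true (adjacent? FGH (g , y) w) adj , mono

  ∑-subtreeLoad : ∀ g → ∑ (allFin n) (subtreeLoad g) ≤ c * (length VH * s)
  ∑-subtreeLoad g = begin
    ∑[ x ∈ allFin n ] ∑[ π ∈ Ps ] ∑[ y ∈ VH ] (F π y * subtreeDegree g x y π)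
      ≡⟨ ∑-comm (allFin n) Ps _ ⟩
    ∑[ π ∈ Ps ] ∑[ x ∈ allFin n ] ∑[ y ∈ VH ] (F π y * subtreeDegree g x y π)
      ≡⟨ ∑-cong Ps (λ π _ → ∑-comm (allFin n) VH _) ⟩
    ∑[ π ∈ Ps ] ∑[ y ∈ VH ] ∑[ x ∈ allFin n ] (F π y * subtreeDegree g x y π)
      ≡⟨ ∑-cong Ps (λ π _ → ∑-cong VH (λ y _ → ∑-*ˡ (allFin n) (F π y) (λ x → subtreeDegree g x y π))) ⟩
    ∑[ π ∈ Ps ] ∑[ y ∈ VH ] (F π y * ∑[ x ∈ allFin n ] subtreeDegree g x y π)
      ≤⟨ ∑-mono-≤ Ps (λ π _ → ∑-mono-≤ VH (λ y _ → degree-≤-c π y)) ⟩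
    ∑[ π ∈ Ps ] ∑[ y ∈ VH ] (F π y * c)
      ≡⟨ ∑-comm Ps VH _ ⟩
    ∑[ y ∈ VH ] ∑[ π ∈ Ps ] (F π y * c)
      ≡⟨ ∑-cong VH (λ y _ → ∑-*ʳ Ps c (λ π → F π y)) ⟩
    ∑[ y ∈ VH ] (load Ps col (g , y) * c)
      ≤⟨ ∑-≤-const VH (λ y _ → *-monoˡ-≤ c (load≤s (g , y))) ⟩
    length VH * (s * c)
      ≡⟨ lemma (length VH) s c ⟩
    c * (length VH * s) ∎
    where
    open ≤-Reasoning
    F : P → V H → ℕ
    F π y = 𝟙 (col (g , y) π)
    degree-≤-c : ∀ π y → F π y * ∑[ x ∈ allFin n ] subtreeDegree g x y π ≤ F π y * c
    degree-≤-c π y with col (g , y) π in coloured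
    ... | true  = *-monoʳ-≤ 1 (∑-subtreeDegree g y π coloured)
    ... | false = z≤n
    lemma : ∀ a b d → a * (b * d) ≡ d * (a * b)
    lemma = solve-∀

  -- Every monochromatic neighbour lies below at most one child, so the children share
  -- a total of at most c · |V H| · s and some child gets at most a 1/n share.
  Light : CV k n → Fin n → Set
  Light g x = n * subtreeLoad g x ≤ c * (length VH * s)

  lightChild : ∀ g → Σ[ x ∈ Fin n ] Light g x
  lightChild g = let x , averaged = ∃-below-average n' (subtreeLoad g) in x , ≤-trans averaged (∑-subtreeLoad g)

  load-layerColouring : ∀ (ch : List (CV k n)) y → load (cartesianProduct ch Ps) (layerColouring col) y ≤ length ch * s
  load-layerColouring ch y = ≤-trans (≤-reflexive (∑-cartesianProduct ch Ps (λ gπ → 𝟙 (layerColouring col y gπ))))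
    (∑-≤-const ch (λ g _ → load≤s (g , y)))

  Defective-layerColouring : Defective c H (layerColouring col)
  Defective-layerColouring (g , π) y coloured (f , f-inj , mono) =
    defective π (g , y) coloured ((g ,_) ∘ f , f-inj ∘ cong proj₂ , λ j → lift (proj₁ (mono j)) , proj₂ (mono j))
    where
    lift : ∀ {y'} → Adj H y y' → Adj (C k n ⊠ H) (g , y) (g , y')
    lift y~y' = (λ e → irreflexive FH y (subst (Adj H y) (sym (cong proj₂ e)) y~y')) , inj₁ (refl , y~y')

  crossPairs-≤-subtreeLoad : ∀ g x ch QH → AllBelow (proj₁ g ++ x ∷ []) ch →
    AllPairs StrictPrefixᶜ ch → Unique QH → IsClique H QH →
    ∑[ π ∈ Ps ] (count col π (map (g ,_) QH) * count col π (cartesianProduct ch QH)) ≤ subtreeLoad g x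
  crossPairs-≤-subtreeLoad g x ch QH below ordered uniqueQH cliqueQH = ∑-mono-≤ Ps (λ π _ → per-colour π)
    where
    rest = cartesianProduct ch QH
    rest-⊆-subtree : ∀ π y → y ∈ QH → count col π rest ≤ subtreeDegree g x y π
    rest-⊆-subtree π y y∈ = begin
      ∑[ w ∈ rest ] 𝟙 (col w π)
        ≡⟨ ∑-cong rest (λ w w∈ → sym (counted w w∈)) ⟩
      ∑[ w ∈ rest ] (𝟙 (inSubtree (proj₁ g) x w) * 𝟙 (does (adjacent? FGH (g , y) w) ∧ col w π))
        ≤⟨ ∑-⊆ rest VGH _ (Unique.cartesianProduct⁺ (Unique-C ordered) uniqueQH) (λ w _ → ∈-vertices FGH w) ⟩
      subtreeDegree g x y π ∎
      where
      open ≤-Reasoning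
      counted : ∀ w → w ∈ rest →
        𝟙 (inSubtree (proj₁ g) x w) * 𝟙 (does (adjacent? FGH (g , y) w) ∧ col w π) ≡ 𝟙 (col w π)
      counted (g' , y') w∈ with ∈-cartesianProduct⁻ ch QH w∈
      ... | g'∈ , y'∈
        rewrite dec-true (Prefix? (proj₁ g ++ x ∷ []) (proj₁ g')) (ListAll.lookup below g'∈)
              | dec-true (adjacent? FGH (g , y) (g' , y'))
                  (StrictPrefix⇒Adj-⊠ {H = H} (Prefix-child⇒StrictPrefix (proj₁ g) x (ListAll.lookup below g'∈))
                                              (cliqueQH y∈ y'∈))
              = +-identityʳ _
    per-colour : ∀ π → count col π (map (g ,_) QH) * count col π rest ≤
                       ∑[ y ∈ VH ] (𝟙 (col (g , y) π) * subtreeDegree g x y π)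
    per-colour π = begin
      count col π (map (g ,_) QH) * count col π rest
        ≡⟨ cong (_* count col π rest) (∑-map (g ,_) QH (λ u → 𝟙 (col u π))) ⟩
      ∑[ y ∈ QH ] 𝟙 (col (g , y) π) * count col π rest
        ≡⟨ ∑-*ʳ QH (count col π rest) (λ y → 𝟙 (col (g , y) π)) ⟨
      ∑[ y ∈ QH ] (𝟙 (col (g , y) π) * count col π rest)
        ≤⟨ ∑-mono-≤ QH (λ y y∈ → *-monoʳ-≤ (𝟙 (col (g , y) π)) (rest-⊆-subtree π y y∈)) ⟩
      ∑[ y ∈ QH ] (𝟙 (col (g , y) π) * subtreeDegree g x y π)
        ≤⟨ ∑-⊆ QH VH _ uniqueQH (λ y _ → ∈-vertices FH y) ⟩
      ∑[ y ∈ VH ] (𝟙 (col (g , y) π) * subtreeDegree g x y π) ∎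
      where open ≤-Reasoning

  ∑-crossPairs : ∀ ch QH → GoodChain Light ch → Unique QH → IsClique H QH →
    n * ∑[ π ∈ Ps ] crossPairs col π ch QH ≤ length ch * (c * (length VH * s))
  ∑-crossPairs []       QH _ _ _ = ≤-reflexive (trans (cong (n *_) (∑-zero Ps)) (*-zeroʳ n))
  ∑-crossPairs (g ∷ ch) QH ((x , light , below) , good) uniqueQH cliqueQH = begin
    n * ∑[ π ∈ Ps ] (layerPairs π + crossPairs col π ch QH)
      ≡⟨ cong (n *_) (∑-distrib-+ Ps layerPairs (λ π → crossPairs col π ch QH)) ⟩
    n * (∑ Ps layerPairs + ∑[ π ∈ Ps ] crossPairs col π ch QH)
      ≡⟨ *-distribˡ-+ n (∑ Ps layerPairs) _ ⟩
    n * ∑ Ps layerPairs + n * ∑[ π ∈ Ps ] crossPairs col π ch QH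
      ≤⟨ +-mono-≤ (≤-trans (*-monoʳ-≤ n layerPairs≤) light) (∑-crossPairs ch QH good uniqueQH cliqueQH) ⟩
    c * (length VH * s) + length ch * (c * (length VH * s)) ∎
    where
    open ≤-Reasoning
    layerPairs : P → ℕ
    layerPairs π = count col π (map (g ,_) QH) * count col π (cartesianProduct ch QH)
    layerPairs≤ = crossPairs-≤-subtreeLoad g x ch QH below (GoodChain⇒AllPairs Light good) uniqueQH cliqueQH

*-≤-half+half : ∀ m a b s → 2 * m * a ≤ s → 2 * m * b ≤ s → m * (a + b) ≤ s
*-≤-half+half m a b s 2ma≤s 2mb≤s = *-cancelˡ-≤ 2 (begin
  2 * (m * (a + b))       ≡⟨ lemma m a b ⟩
  2 * m * a + 2 * m * b   ≤⟨ +-mono-≤ 2ma≤s 2mb≤s ⟩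
  s + s                   ≡⟨ cong (s +_) (+-identityʳ s) ⟨
  2 * s                   ∎)
  where
  open ≤-Reasoning
  lemma : ∀ m a b → 2 * (m * (a + b)) ≡ 2 * m * a + 2 * m * b
  lemma = solve-∀

*-≤-from-ratio : ∀ m D n' X s → suc n' * X ≤ D * s → 2 * m * D ≤ n' → 2 * m * X ≤ s
*-≤-from-ratio m zero n' X s X≤0 _ with m*n≡0⇒m≡0∨n≡0 (suc n') (n≤0⇒n≡0 X≤0)
... | inj₂ refl = ≤-trans (≤-reflexive (*-zeroʳ (2 * m))) z≤n
*-≤-from-ratio m (suc D) n' X s sX≤Ds 2mD≤n' = *-cancelˡ-≤ (suc D) (begin
  suc D * (2 * m * X)   ≡⟨ lemma m D X ⟩
  2 * m * suc D * X     ≤⟨ *-monoˡ-≤ X 2mD≤n' ⟩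
  n' * X                ≤⟨ m≤n+m (n' * X) X ⟩
  suc n' * X            ≤⟨ sX≤Ds ⟩
  suc D * s             ∎)
  where
  open ≤-Reasoning
  lemma : ∀ m D X → suc D * (2 * m * X) ≡ 2 * m * suc D * X
  lemma = solve-∀

-- The clique is path × QH. Its monochromatic pairs inside one layer are controlled by the
-- hypothesis on H, those across layers by the lightness of the path; each part is ≤ s/(2m).
sparseCliques-C⊠ : ∀ k n' {H} (FH : Finite H) K c m → SparseCliques H K c (2 * m * k) →
  2 * m * (k * (c * length (vertices FH))) ≤ n' → SparseCliques (C k (suc n') ⊠ H) (k * K) c m
sparseCliques-C⊠ zero n' FH K c m _ _ P Ps s col _ _ =
  [] , refl , [] , (λ ()) , ≤-trans (≤-reflexive (trans (cong (m *_) (∑-zero Ps)) (*-zeroʳ m))) z≤n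
sparseCliques-C⊠ (suc k') n' {H} FH K c m sparseH n'-large P Ps s col load≤s defective =
  stack (greedyChain Light lightChild)
  where
  k = suc k'
  open LightChain k n' FH Ps s c col load≤s defective
  stack : Σ[ ch ∈ List (CV k n) ] (length ch ≡ k × GoodChain Light ch) →
    Σ[ Q ∈ List (V (C k n ⊠ H)) ] (length Q ≡ k * K × Unique Q × IsClique (C k n ⊠ H) Q × m * clash Ps col Q ≤ s)
  stack (ch , ∣ch∣≡k , good)
    with sparseH (CV k n × P) (cartesianProduct ch Ps) (k * s) (layerColouring col)
           (λ y → subst (λ l → load (cartesianProduct ch Ps) (layerColouring col) y ≤ l * s) ∣ch∣≡k
                        (load-layerColouring ch y))
           Defective-layerColouring
  ... | QH , ∣QH∣≡K , uniqueQH , cliqueQH , layer-bound =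
    cartesianProduct ch QH ,
    trans (length-cartesianProduct ch QH) (cong₂ _*_ ∣ch∣≡k ∣QH∣≡K) ,
    Unique.cartesianProduct⁺ (Unique-C ordered) uniqueQH ,
    IsClique-cartesianProduct (irreflexive (finite-C k n)) (irreflexive FH) (IsClique-C ordered) cliqueQH ,
    subst (λ z → m * z ≤ s) (sym (clash-cartesianProduct col Ps ch QH))
      (*-≤-half+half m _ cross s
        (*-cancelˡ-≤ k (≤-trans (≤-reflexive (lemma₁ m k' _)) layer-bound))
        (*-≤-from-ratio m (k * (c * length VH)) n' cross s cross-bound n'-large))
    where
    lemma₁ : ∀ m k' a → suc k' * (2 * m * a) ≡ 2 * m * suc k' * a
    lemma₁ = solve-∀
    lemma₂ : ∀ k c N s → k * (c * (N * s)) ≡ k * (c * N) * s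
    lemma₂ = solve-∀
    ordered = GoodChain⇒AllPairs Light good
    cross = ∑[ π ∈ Ps ] crossPairs col π ch QH
    cross-bound : suc n' * cross ≤ k * (c * length VH) * s
    cross-bound = ≤-trans (∑-crossPairs ch QH good uniqueQH cliqueQH)
      (≤-reflexive (trans (cong (_* (c * (length VH * s))) ∣ch∣≡k) (lemma₂ k c (length VH) s)))

sparseCliques-UnitGraph : ∀ c m → SparseCliques UnitGraph 1 c m
sparseCliques-UnitGraph c m P Ps s col _ _ =
  tt ∷ [] , refl , [] ∷ [] , (λ { (here refl) (here refl) → inj₁ refl }) ,
  ≤-trans (≤-reflexive (trans (cong (m *_) no-pairs) (*-zeroʳ m))) z≤n
  where
  no-pairs : clash Ps col (tt ∷ []) ≡ 0
  no-pairs = trans (∑-cong Ps (λ π _ → trans (+-identityʳ _) (*-zeroʳ (𝟙 (col tt π))))) (∑-zero Ps)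

-- ⊠C ends in a bare C k n, so the one-factor case goes through C k n ⊠ UnitGraph.
sparseCliques-⊠UnitGraph : ∀ {G} K c m → SparseCliques (G ⊠ UnitGraph) K c m → SparseCliques G K c m
sparseCliques-⊠UnitGraph {G} K c m sparse P Ps s col load≤s defective
  with sparse P Ps s (col ∘ proj₁) (load≤s ∘ proj₁) defective-⊠
  where
  defective-⊠ : Defective c (G ⊠ UnitGraph) (col ∘ proj₁)
  defective-⊠ π (v , tt) coloured (f , f-inj , mono) =
    defective π v coloured (proj₁ ∘ f , f-inj ∘ cong (_, tt) , λ j → along-G (proj₁ (mono j)) , proj₂ (mono j))
    where
    along-G : ∀ {w} → Adj (G ⊠ UnitGraph) (v , tt) w → Adj G v (proj₁ w)
    along-G (_ , inj₂ (inj₁ (_ , v~w))) = v~w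
... | Q , ∣Q∣≡K , uniqueQ , cliqueQ , bound =
  map proj₁ Q , trans (length-map proj₁ Q) ∣Q∣≡K , Unique.map⁺ (cong (_, tt)) uniqueQ , clique ,
  subst (λ z → m * z ≤ s) (sym (∑-cong Ps (λ π _ → monoPairs-map col π proj₁ Q))) bound
  where
  clique : IsClique G (map proj₁ Q)
  clique u∈ w∈ with ∈-map⁻ proj₁ u∈ | ∈-map⁻ proj₁ w∈
  ... | u' , u'∈ , refl | w' , w'∈ , refl with cliqueQ u'∈ w'∈
  ...   | inj₁ refl                        = inj₁ refl
  ...   | inj₂ (_ , inj₂ (inj₁ (_ , u~w))) = inj₂ u~w

sparseCliques-⊠C : ∀ {d} (ks : Vec ℕ (suc d)) c m → Σ[ ns ∈ Vec ℕ (suc d) ] SparseCliques (⊠C ks ns) (prodVec ks) c m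
sparseCliques-⊠C (k ∷ []) c m = suc n' ∷ [] ,
  sparseCliques-⊠UnitGraph (k * 1) c m
    (sparseCliques-C⊠ k n' finite-UnitGraph 1 c m (sparseCliques-UnitGraph c (2 * m * k)) ≤-refl)
  where n' = 2 * m * (k * (c * 1))
sparseCliques-⊠C (k ∷ k' ∷ ks) c m with sparseCliques-⊠C (k' ∷ ks) c (2 * m * k)
... | n'' ∷ ns , sparse = suc n' ∷ n'' ∷ ns ,
  sparseCliques-C⊠ k n' (finite-⊠C (k' ∷ ks) (n'' ∷ ns)) (prodVec (k' ∷ ks)) c m sparse ≤-refl
  where n' = 2 * m * (k * (c * length (vertices (finite-⊠C (k' ∷ ks) (n'' ∷ ns)))))

∑-allFin-suc : ∀ p (f : Fin (suc p) → ℕ) → ∑ (allFin (suc p)) f ≡ f zero + ∑[ α ∈ allFin p ] f (suc α)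
∑-allFin-suc p f = cong (f zero +_) (trans (cong (λ L → ∑ L f) (sym (map-tabulate id suc))) (∑-map suc (allFin p) f))

∑-lookup≡∣∣ : ∀ {p} (S : Subset p) → ∑[ α ∈ allFin p ] 𝟙 (Vec.lookup S α) ≡ ∣ S ∣
∑-lookup≡∣∣ []            = refl
∑-lookup≡∣∣ {suc p} (b ∷ S) = trans (∑-allFin-suc p (λ α → 𝟙 (Vec.lookup (b ∷ S) α))) (with-head b)
  where
  with-head : ∀ b → 𝟙 b + ∑[ α ∈ allFin p ] 𝟙 (Vec.lookup S α) ≡ ∣ b ∷ S ∣
  with-head true  = cong suc (∑-lookup≡∣∣ S)
  with-head false = ∑-lookup≡∣∣ S

Defect⇒Defective : ∀ {c} (G : Graph) {p} (S : V G → Subset p) → Defect c G S → Defective c G (λ v α → Vec.lookup (S v) α)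
Defect⇒Defective G S defect α v α∈Sv (f , f-inj , mono) =
  defect α v (lookup⇒[]= α (S v) α∈Sv)
    (f , f-inj , λ j → proj₁ (mono j) , lookup⇒[]= α (S v) α∈Sv , lookup⇒[]= α (S (f j)) (proj₂ (mono j)))

fractional-defect-bound : ∀ {d} (ks : Vec ℕ (suc d)) c m → Σ[ ns ∈ Vec ℕ (suc d) ]
  (∀ p q (S : V (⊠C ks ns) → Subset p) → (∀ v → ∣ S v ∣ ≡ q) → Defect c (⊠C ks ns) S →
     m * (prodVec ks * q) ≤ m * p + q)
fractional-defect-bound ks c m with sparseCliques-⊠C ks c m
... | ns , sparse = ns , bound
  where
  colouring : ∀ {p} → (V (⊠C ks ns) → Subset p) → Colouring (⊠C ks ns) (Fin p)
  colouring S v α = Vec.lookup (S v) α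
  load≡q : ∀ {p q} (S : V (⊠C ks ns) → Subset p) → (∀ v → ∣ S v ∣ ≡ q) →
    ∀ v → load (allFin p) (colouring S) v ≡ q
  load≡q S ∣S∣≡q v = trans (∑-lookup≡∣∣ (S v)) (∣S∣≡q v)
  bound : ∀ p q (S : V (⊠C ks ns) → Subset p) → (∀ v → ∣ S v ∣ ≡ q) → Defect c (⊠C ks ns) S →
    m * (prodVec ks * q) ≤ m * p + q
  bound p q S ∣S∣≡q defect
    with sparse (Fin p) (allFin p) q (colouring S) (λ v → ≤-reflexive (load≡q S ∣S∣≡q v))
           (Defect⇒Defective (⊠C ks ns) S defect)
  ... | Q , ∣Q∣≡K , _ , _ , m*clash≤q = begin
    m * (prodVec ks * q)
      ≡⟨ cong (λ l → m * (l * q)) ∣Q∣≡K ⟨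
    m * (length Q * q)
      ≡⟨ cong (m *_) (∑-const Q (λ u _ → load≡q S ∣S∣≡q u)) ⟨
    m * ∑[ u ∈ Q ] load (allFin p) col u
      ≡⟨ cong (m *_) (∑-comm Q (allFin p) _) ⟩
    m * ∑[ α ∈ allFin p ] count col α Q
      ≤⟨ *-monoʳ-≤ m (∑-mono-≤ (allFin p) (λ α _ → count-≤-1+monoPairs col α Q)) ⟩
    m * ∑[ α ∈ allFin p ] (1 + monoPairs col α Q)
      ≡⟨ cong (m *_) (∑-distrib-+ (allFin p) (λ _ → 1) _) ⟩
    m * (∑[ _ ∈ allFin p ] 1 + clash (allFin p) col Q)
      ≡⟨ *-distribˡ-+ m _ _ ⟩
    m * ∑[ _ ∈ allFin p ] 1 + m * clash (allFin p) col Q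
      ≤⟨ +-monoʳ-≤ _ m*clash≤q ⟩
    m * ∑[ _ ∈ allFin p ] 1 + q
      ≡⟨ cong (λ l → m * l + q) (trans (∑-length (allFin p)) (length-tabulate id)) ⟩
    m * p + q ∎
    where
    open ≤-Reasoning
    col = colouring S

-- p/q ≤ a/b < K is incompatible with p/q ≥ K − 1/(2b).
fractional-bound-contradiction : ∀ K b a p q → 2 * b * (K * q) ≤ 2 * b * p + q → p * b ≤ a * q → a < K * b → 1 ≤ q → ⊥
fractional-bound-contradiction K b a p q bound pb≤aq a<Kb 1≤q = <-irrefl refl (begin-strict
  2 * a * q + q       <⟨ +-monoʳ-< (2 * a * q) (m<m+n q 1≤q) ⟩
  2 * a * q + (q + q) ≡⟨ lemma₁ a q ⟩
  2 * suc a * q       ≤⟨ *-monoˡ-≤ q (*-monoʳ-≤ 2 a<Kb) ⟩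
  2 * (K * b) * q     ≡⟨ lemma₂ K b q ⟩
  2 * b * (K * q)     ≤⟨ bound ⟩
  2 * b * p + q       ≡⟨ lemma₃ b p q ⟩
  2 * (p * b) + q     ≤⟨ +-monoˡ-≤ q (*-monoʳ-≤ 2 pb≤aq) ⟩
  2 * (a * q) + q     ≡⟨ cong (_+ q) (*-assoc 2 a q) ⟨
  2 * a * q + q       ∎)
  where
  open ≤-Reasoning
  lemma₁ : ∀ a q → 2 * a * q + (q + q) ≡ 2 * suc a * q
  lemma₁ = solve-∀
  lemma₂ : ∀ K b q → 2 * (K * b) * q ≡ 2 * b * (K * q)
  lemma₂ = solve-∀
  lemma₃ : ∀ b p q → 2 * b * p + q ≡ 2 * (p * b) + q
  lemma₃ = solve-∀

no-FracCol-below : ∀ {d} (ks : Vec ℕ (suc d)) c b →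
  Σ[ ns ∈ Vec ℕ (suc d) ] (∀ a → a < prodVec ks * b → ¬ FracCol (⊠C ks ns) (Defect c) a b)
no-FracCol-below ks c b with fractional-defect-bound ks c (2 * b)
... | ns , bound = ns , λ a a<Kb (p , q , 1≤q , pb≤aq , _ , S , ∣S∣≡q , defect) →
  fractional-bound-contradiction (prodVec ks) b a p q (bound p q S ∣S∣≡q defect) pb≤aq a<Kb 1≤q

NoMonoEdge : ColProp
NoMonoEdge G col = ∀ α v w → ¬ MonoAdj G col α v w

_⇒ᶜ_ : ColProp → ColProp → Set₁
P ⇒ᶜ Q = ∀ {G p} (col : V G → Subset p) → P G col → Q G col

NoMonoEdge⇒Defect : ∀ c → NoMonoEdge ⇒ᶜ Defect c
NoMonoEdge⇒Defect c col none α v _ (f , _ , mono) = none α v (f zero) (mono zero)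

NoMonoEdge⇒Clustering : ∀ c → NoMonoEdge ⇒ᶜ Clustering (suc c)
NoMonoEdge⇒Clustering c {G} col none α v _ (f , f-inj , connected) with f-inj {zero} {suc zero}
  (trans (sym (trivial (connected zero))) (trivial (connected (suc zero))))
  where
  trivial : ∀ {w} → Star (MonoAdj G col α) v w → v ≡ w
  trivial ε           = refl
  trivial (edge ◅ _) = ⊥-elim (none α v _ edge)
... | ()

Clustering⇒Defect : ∀ c → Clustering c ⇒ᶜ Defect c
Clustering⇒Defect c col clustered α v α∈ (f , f-inj , mono) = clustered α v α∈ (f , f-inj , λ j → mono j ◅ ε)

FracCol-map : ∀ G P Q {a b} → P ⇒ᶜ Q → FracCol G P a b → FracCol G Q a b
FracCol-map _ _ _ P⇒Q (p , q , 1≤q , pb≤aq , q≤p , col , ∣col∣≡q , Pcol) =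
  p , q , 1≤q , pb≤aq , q≤p , col , ∣col∣≡q , P⇒Q col Pcol

KCol⇒FracCol : ∀ G P {k a b} → KCol G P k → k * b ≤ a → FracCol G P a b
KCol⇒FracCol _ _ {a = a} kcol kb≤a = _ , 1 , ≤-refl , subst (_ ≤_) (sym (*-identityʳ a)) kb≤a , kcol

depth : ∀ {k n} → CV k n → Fin k
depth (_ , ∣s∣<k) = Fin.fromℕ< ∣s∣<k

depth-Adj : ∀ {k n} {u w : CV k n} → Adj (C k n) u w → depth u ≢ depth w
depth-Adj {u = _ , ∣s∣<k} {_ , ∣t∣<k} (inj₁ sp) e =
  <-irrefl (trans (sym (toℕ-fromℕ< ∣s∣<k)) (trans (cong Fin.toℕ e) (toℕ-fromℕ< ∣t∣<k))) (StrictPrefix⇒length-< sp)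
depth-Adj {u = _ , ∣s∣<k} {_ , ∣t∣<k} (inj₂ sp) e =
  <-irrefl (trans (sym (toℕ-fromℕ< ∣t∣<k)) (trans (cong Fin.toℕ (sym e)) (toℕ-fromℕ< ∣s∣<k))) (StrictPrefix⇒length-< sp)

depthColour : ∀ {d} (ks ns : Vec ℕ (suc d)) → V (⊠C ks ns) → Fin (prodVec ks)
depthColour (k ∷ [])      (n ∷ [])      v       = Fin.combine (depth v) zero
depthColour (k ∷ k' ∷ ks) (n ∷ n' ∷ ns) (g , y) = Fin.combine (depth g) (depthColour (k' ∷ ks) (n' ∷ ns) y)

depthColour-Adj : ∀ {d} (ks ns : Vec ℕ (suc d)) {u w} → Adj (⊠C ks ns) u w → depthColour ks ns u ≢ depthColour ks ns w
depthColour-Adj (k ∷ []) (n ∷ []) {u} {w} u~w e =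
  depth-Adj {k} {n} {u} {w} u~w (proj₁ (combine-injective (depth u) zero (depth w) zero e))
depthColour-Adj (k ∷ k' ∷ ks) (n ∷ n' ∷ ns) {g , y} {h , z} (_ , g~h) e with g~h
  | combine-injective (depth g) (depthColour (k' ∷ ks) (n' ∷ ns) y) (depth h) (depthColour (k' ∷ ks) (n' ∷ ns) z) e
... | inj₁ (_ , y~z)        | _ , same-y = depthColour-Adj (k' ∷ ks) (n' ∷ ns) y~z same-y
... | inj₂ (inj₁ (_ , g~h)) | same-g , _ = depth-Adj {k} {n} {g} {h} g~h same-g
... | inj₂ (inj₂ (g~h , _)) | same-g , _ = depth-Adj {k} {n} {g} {h} g~h same-g

depthColouring-KCol : ∀ {d} (ks : Vec ℕ (suc d)) → All (1 ≤_) ks → ∀ ns {P} → NoMonoEdge ⇒ᶜ P →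
  KCol (⊠C ks ns) P (prodVec ks)
depthColouring-KCol ks 1≤ks ns NoMonoEdge⇒P =
  prodVec-≥1 ks 1≤ks , singleton , (λ v → ∣⁅x⁆∣≡1 (depthColour ks ns v)) , NoMonoEdge⇒P singleton no-mono-edge
  where
  singleton : V (⊠C ks ns) → Subset (prodVec ks)
  singleton v = ⁅ depthColour ks ns v ⁆
  no-mono-edge : NoMonoEdge (⊠C ks ns) singleton
  no-mono-edge α v w (v~w , α∈v , α∈w) =
    depthColour-Adj ks ns v~w (trans (sym (x∈⁅y⁆⇒x≡y _ α∈v)) (x∈⁅y⁆⇒x≡y _ α∈w))
  prodVec-≥1 : ∀ {d} (ks : Vec ℕ d) → All (1 ≤_) ks → 1 ≤ prodVec ks
  prodVec-≥1 []       []         = s≤s z≤n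
  prodVec-≥1 (k ∷ ks) (1≤k ∷ 1≤ks) = *-mono-≤ 1≤k (prodVec-≥1 ks 1≤ks)

no-KCol-below : ∀ {d} (ks : Vec ℕ (suc d)) c →
  Σ[ ns ∈ Vec ℕ (suc d) ] (∀ k → k < prodVec ks → ¬ KCol (⊠C ks ns) (Defect c) k)
no-KCol-below ks c = let ns , none = no-FracCol-below ks c 1 in
  ns , λ k k<K kcol → none k (subst (k <_) (sym (*-identityʳ (prodVec ks))) k<K)
                             (KCol⇒FracCol (⊠C ks ns) (Defect c) kcol (≤-reflexive (*-identityʳ k)))

midpoint-fraction : ∀ K a b → 1 ≤ b → a < K * b → a * (2 * b) < suc (2 * a) * b × suc (2 * a) < K * (2 * b)
midpoint-fraction K a b 1≤b a<Kb =
  subst₂ _<_ (+-identityʳ _) (lemma₁ a b) (+-monoʳ-< (a * (2 * b)) 1≤b) ,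
  subst (suc (2 * a) <_) (lemma₂ K b) (subst (_≤ 2 * (K * b)) (lemma₃ a) (*-monoʳ-≤ 2 a<Kb))
  where
  lemma₁ : ∀ a b → a * (2 * b) + b ≡ suc (2 * a) * b
  lemma₁ = solve-∀
  lemma₂ : ∀ K b → 2 * (K * b) ≡ K * (2 * b)
  lemma₂ = solve-∀
  lemma₃ : ∀ a → 2 * suc a ≡ suc (suc (2 * a))
  lemma₃ = solve-∀

module _ {d} (ks : Vec ℕ (suc d)) (1≤ks : All (1 ≤_) ks) where

  fracParamEq : (P : ℕ → ColProp) (c₀ : ℕ) → NoMonoEdge ⇒ᶜ P c₀ → (∀ c → P c ⇒ᶜ Defect c) →
    FracParamEq (⊠C ks) P (prodVec ks)
  fracParamEq P c₀ upper lower =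
    (λ a b _ Kb<a → c₀ , λ ns → KCol⇒FracCol (⊠C ks ns) (P c₀) (depthColouring-KCol ks 1≤ks ns upper) (<⇒≤ Kb<a)) ,
    (λ a b _ a<Kb (c , all) → let ns , none = no-FracCol-below ks c b in
       none a a<Kb (FracCol-map (⊠C ks ns) (P c) (Defect c) {a} {b} (lower c) (all ns)))

  chiParamEq : (P : ℕ → ColProp) (c₀ : ℕ) → NoMonoEdge ⇒ᶜ P c₀ → (∀ c → P c ⇒ᶜ Defect c) →
    ChiParamEq (⊠C ks) P (prodVec ks)
  chiParamEq P c₀ upper lower =
    (c₀ , λ ns → depthColouring-KCol ks 1≤ks ns upper) ,
    (λ k k<K (c , all) → let ns , none = no-KCol-below ks c in none k k<K (KCol-map (⊠C ks ns) (P c) (Defect c) (lower c) (all ns)))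
    where
    KCol-map : ∀ G P Q {k} → P ⇒ᶜ Q → KCol G P k → KCol G Q k
    KCol-map _ _ _ P⇒Q (1≤k , col , ∣col∣≡1 , Pcol) = 1≤k , col , ∣col∣≡1 , P⇒Q col Pcol

  fracChiEq : FracChiEq (⊠C ks) (prodVec ks)
  fracChiEq =
    (λ ns a b _ Kb<a →
       KCol⇒FracCol (⊠C ks ns) Proper (depthColouring-KCol ks 1≤ks ns (NoMonoEdge⇒Clustering 0)) (<⇒≤ Kb<a)) ,
    λ a b 1≤b a<Kb → let ns , none = no-FracCol-below ks 1 (2 * b)
                         above-a/b , below-K = midpoint-fraction (prodVec ks) a b 1≤b a<Kb in
      ns , suc (2 * a) , 2 * b , ≤-trans 1≤b (m≤m+n b _) , above-a/b ,
      λ frac → none (suc (2 * a)) below-K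
                 (FracCol-map (⊠C ks ns) Proper (Defect 1) {suc (2 * a)} {2 * b} (Clustering⇒Defect 1) frac)

  chiEq : ChiEq (⊠C ks) (prodVec ks)
  chiEq =
    (λ ns → prodVec ks , ≤-refl , depthColouring-KCol ks 1≤ks ns (NoMonoEdge⇒Clustering 0)) ,
    (let ns , none = no-KCol-below ks 1 in
     ns , λ k k<K (1≤k , col , ∣col∣≡1 , proper) → none k k<K (1≤k , col , ∣col∣≡1 , Clustering⇒Defect 1 col proper))

mainTheorem1 : (d : ℕ) (ks : Vec ℕ (suc d)) → All (1 ≤_) ks →
    FracParamEq (⊠C ks) Defect (prodVec ks) ×
    FracParamEq (⊠C ks) Clustering (prodVec ks) ×
    FracChiEq (⊠C ks) (prodVec ks) ×
    ChiParamEq (⊠C ks) Defect (prodVec ks) ×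
    ChiParamEq (⊠C ks) Clustering (prodVec ks) ×
    ChiEq (⊠C ks) (prodVec ks)
mainTheorem1 d ks 1≤ks =
  fracParamEq ks 1≤ks Defect 0 (NoMonoEdge⇒Defect 0) (λ _ _ defect → defect) ,
  fracParamEq ks 1≤ks Clustering 1 (NoMonoEdge⇒Clustering 0) Clustering⇒Defect ,
  fracChiEq ks 1≤ks ,
  chiParamEq ks 1≤ks Defect 0 (NoMonoEdge⇒Defect 0) (λ _ _ defect → defect) ,
  chiParamEq ks 1≤ks Clustering 1 (NoMonoEdge⇒Clustering 0) Clustering⇒Defect ,
  chiEq ks 1≤ks
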